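{- Let $\mathcal G=(\mathcal X,\mathcal A,Q,V)$ be a $k$-player game. Suppose $y\in\mathcal X$ and $j\in[k]$ are such that $y$ is the unique input with $Q(y)>0$ whose $j$-th component equals $y^j$. Then there exists a predicate $V':\mathcal X\times\mathcal A\to\{0,1\}$ such that the game $\mathcal G'=(\mathcal X,\mathcal A,Q,V')$ satisfies: (a) for all $a,b\in\mathcal A$ with $a^{ -j}=b^{ -j}$, $V'(y,a)=V'(y,b)$; (b) for every $n\in\mathbb N$, $\mathrm{val}(\mathcal G^{\otimes n})\le \mathrm{val}(\mathcal G'^{\otimes n})$; (c) $\mathrm{val}(\mathcal G')=\mathrm{val}(\mathcal G)$.
   Context: A $k$-player game $\mathcal G=(\mathcal X,\mathcal A,Q,V)$ has finite question set $\mathcal X=\mathcal X^1\times\dots\times\mathcal X^k$, finite answer set $\mathcal A=\mathcal A^1\times\dots\times\mathcal A^k$, distribution $Q$ on $\mathcal X$, and predicate $V:\mathcal X\times\mathcal A\to\{0,1\}$; $\mathrm{val}$ is the maximum over deterministic strategies $f^j:\mathcal X^j\to\mathcal A^j$ of $\Pr_{x\sim Q}[V(x,(f^j(x^j))_j)=1]$, and $\mathcal G^{\otimes n}$ is the $n$-fold parallel repetition (i.i.d. questions, win iff $V$ holds in all coordinates). For $a\in\mathcal A$, $a^{ -j}$ denotes the tuple of all components except the $j$-th.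
   Formalization: The probabilities of the distribution $Q$ are rational. -}

module Defs where

open import Data.Nat using (ℕ; zero; suc)
open import Data.Fin using (Fin; zero; suc)
open import Data.Bool using (Bool; true; false; _∧_; if_then_else_)
open import Data.Unit using (⊤; tt)
open import Data.Product using (_×_; _,_; Σ; ∃)
open import Data.List using (List; []; _∷_; map; concatMap; foldr; allFin)
open import Data.Vec as Vec using (Vec; []; _∷_; tabulate; lookup)
open import Data.Rational using (ℚ; 0ℚ; 1ℚ; _+_; _*_; _≤_)
open import Relation.Binary.PropositionalEquality using (_≡_)

Tuple : ∀ {k} → (Fin k → ℕ) → Set
Tuple {zero} s = ⊤
Tuple {suc k} s = Fin (s zero) × Tuple (λ i → s (suc i))

comp : ∀ {k} {s : Fin k → ℕ} → Tuple s → (j : Fin k) → Fin (s j)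
comp {suc k} (a , x) zero = a
comp {suc k} (a , x) (suc j) = comp x j

build : ∀ {k} {s : Fin k → ℕ} → ((j : Fin k) → Fin (s j)) → Tuple s
build {zero} f = tt
build {suc k} f = f zero , build (λ i → f (suc i))

allTuples : ∀ {k} (s : Fin k → ℕ) → List (Tuple s)
allTuples {zero} s = tt ∷ []
allTuples {suc k} s =
  concatMap (λ a → map (λ x → (a , x)) (allTuples (λ i → s (suc i)))) (allFin (s zero))

allVecs : ∀ {A : Set} (n : ℕ) → List A → List (Vec A n)
allVecs zero L = [] ∷ []
allVecs (suc n) L = concatMap (λ a → map (λ v → a ∷ v) (allVecs n L)) L

sumℚ : List ℚ → ℚ
sumℚ = foldr _+_ 0ℚ

prodVec : ∀ {n} → Vec ℚ n → ℚ
prodVec = Vec.foldr _ _*_ 1ℚ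

andVec : ∀ {n} → Vec Bool n → Bool
andVec = Vec.foldr _ _∧_ true

ind : Bool → ℚ
ind b = if b then 1ℚ else 0ℚ

-- A k-player game (X, A, Q, V) with X^j = Fin (qs j), A^j = Fin (as j);
-- Q is a probability distribution on X.
record Game (k : ℕ) : Set where
  field
    qs : Fin k → ℕ
    as : Fin k → ℕ
    Q : Tuple qs → ℚ
    V : Tuple qs → Tuple as → Bool
    Q-nonneg : ∀ x → 0ℚ ≤ Q x
    Q-sum : sumℚ (map Q (allTuples qs)) ≡ 1ℚ

open Game public

withV : ∀ {k} (G : Game k) → (Tuple (qs G) → Tuple (as G) → Bool) → Game k
withV G V' = record G { V = V' }

Strategy : ∀ {k} → Game k → Set
Strategy {k} G = (j : Fin k) → Fin (qs G j) → Fin (as G j)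

play : ∀ {k} (G : Game k) → Strategy G → Tuple (qs G) → Tuple (as G)
play G f x = build (λ j → f j (comp x j))

winProb : ∀ {k} (G : Game k) → Strategy G → ℚ
winProb G f = sumℚ (map (λ x → Q G x * ind (V G x (play G f x))) (allTuples (qs G)))

IsVal : ∀ {k} → Game k → ℚ → Set
IsVal G v = (Σ (Strategy G) λ f → winProb G f ≡ v) × (∀ f → winProb G f ≤ v)

RepStrategy : ∀ {k} → ℕ → Game k → Set
RepStrategy {k} n G = (j : Fin k) → Vec (Fin (qs G j)) n → Vec (Fin (as G j)) n

column : ∀ {k n} (G : Game k) → Vec (Tuple (qs G)) n → (j : Fin k) → Vec (Fin (qs G j)) n
column G xs j = Vec.map (λ x → comp x j) xs

playRep : ∀ {k n} (G : Game k) → RepStrategy n G → Vec (Tuple (qs G)) n → Vec (Tuple (as G)) n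
playRep G F xs = tabulate (λ i → build (λ j → lookup (F j (column G xs j)) i))

winProbRep : ∀ {k} (n : ℕ) (G : Game k) → RepStrategy n G → ℚ
winProbRep n G F = sumℚ (map (λ xs → prodVec (Vec.map (Q G) xs)
                                   * ind (andVec (Vec.zipWith (V G) xs (playRep G F xs))))
                             (allVecs n (allTuples (qs G))))

IsValRep : ∀ {k} → ℕ → Game k → ℚ → Set
IsValRep n G v = (Σ (RepStrategy n G) λ F → winProbRep n G F ≡ v) × (∀ F → winProbRep n G F ≤ v)

{-# OPTIONS --safe #-}
module Submission where

-- Let V′ agree with V except on questions x with x^j = y^j, where V′ (x , a) holds as soon as
-- V (x , a′) holds for some a′ that differs from a only in player j's answer. Since V implies V′,
-- every strategy, single or repeated, wins G′ at least as often as G; this gives (b) and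
-- val G ≤ val G′. Conversely, up to probability zero player j sees y^j only when the question
-- is y, and then he knows the other players' answers; answering the best response to them turns
-- any strategy for G′ into one for G with the same winning probability, so val G′ ≤ val G.

open import Defs
open import Data.Nat using (ℕ; zero; suc)
open import Data.Fin using (Fin; zero; suc; _≟_)
open import Data.Fin.Properties using (any?; suc-injective)
open import Data.Bool using (Bool; true; false; if_then_else_; T)
open import Data.Bool.Properties using (T-≡; T-∧)
open import Data.Empty using (⊥-elim)
open import Data.Product using (_×_; Σ; ∃; _,_; proj₁; proj₂)
open import Data.List using (List; []; _∷_; map)
open import Data.List.Properties using (map-cong)
open import Data.Vec as Vec using (Vec; []; _∷_)
open import Data.Rational using (ℚ; 0ℚ; 1ℚ; _<_; _≤_; _*_; nonNegative)
open import Data.Rational.Properties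
  using (≤-refl; ≤-reflexive; ≤-trans; ≤-antisym; <-irrefl; <-≤-trans; <-cmp; +-mono-≤;
         *-zeroˡ; *-monoˡ-≤-nonNeg; nonNegative⁻¹; nonNeg*nonNeg⇒nonNeg)
open import Function using (_∘_; Equivalence; mk⇔)
open import Relation.Binary using (tri<; tri≈; tri>)
open import Relation.Binary.PropositionalEquality
  using (_≡_; _≢_; _≗_; refl; sym; trans; cong; subst; module ≡-Reasoning)
open import Relation.Nullary.Decidable using (does; yes; no; T?; dec-true; dec-false; does-⇔)

open Equivalence using (to; from)

private
  variable
    k : ℕ
    B : Fin k → Set

update : ((i : Fin k) → B i) → (j : Fin k) → B j → (i : Fin k) → B i
update f zero    b zero    = b
update f zero    b (suc i) = f (suc i)
update f (suc j) b zero    = f zero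
update f (suc j) b (suc i) = update (f ∘ suc) j b i

update-same : ∀ (f : (i : Fin k) → B i) j b → update f j b j ≡ b
update-same f zero    b = refl
update-same f (suc j) b = update-same (f ∘ suc) j b

update-other : ∀ (f : (i : Fin k) → B i) j b {i} → i ≢ j → update f j b i ≡ f i
update-other f zero    b {zero}  i≢j = ⊥-elim (i≢j refl)
update-other f zero    b {suc i} _   = refl
update-other f (suc j) b {zero}  _   = refl
update-other f (suc j) b {suc i} i≢j = update-other (f ∘ suc) j b (i≢j ∘ cong suc)

update-id : ∀ (f : (i : Fin k) → B i) j i → update f j (f j) i ≡ f i
update-id f zero    zero    = refl
update-id f zero    (suc i) = refl
update-id f (suc j) zero    = refl
update-id f (suc j) (suc i) = update-id (f ∘ suc) j i

update-cong : ∀ {f g : (i : Fin k) → B i} j b → (∀ i → i ≢ j → f i ≡ g i) →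
              ∀ i → update f j b i ≡ update g j b i
update-cong zero    b f≡g zero    = refl
update-cong zero    b f≡g (suc i) = f≡g (suc i) λ ()
update-cong (suc j) b f≡g zero    = f≡g zero λ ()
update-cong (suc j) b f≡g (suc i) =
  update-cong j b (λ i i≢j → f≡g (suc i) (i≢j ∘ suc-injective)) i

update-apply : ∀ {A : Fin k → Set} {f : (i : Fin k) → A i → B i} {g : (i : Fin k) → B i}
               (x : (i : Fin k) → A i) j h → (∀ i → i ≢ j → f i (x i) ≡ g i) →
               ∀ i → update f j h i (x i) ≡ update g j (h (x j)) i
update-apply x zero    h fx≡g zero    = refl
update-apply x zero    h fx≡g (suc i) = fx≡g (suc i) λ ()
update-apply x (suc j) h fx≡g zero    = fx≡g zero λ ()
update-apply x (suc j) h fx≡g (suc i) =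
  update-apply (λ i → x (suc i)) j h (λ i i≢j → fx≡g (suc i) (i≢j ∘ suc-injective)) i

Tuple-ext : ∀ {k} {s : Fin k → ℕ} {a b : Tuple s} → (∀ i → comp a i ≡ comp b i) → a ≡ b
Tuple-ext {zero}              _   = refl
Tuple-ext {suc k} {a = a , _} a≡b with refl ← a≡b zero =
  cong (a ,_) (Tuple-ext λ i → a≡b (suc i))

comp-build : ∀ {k} {s : Fin k → ℕ} (h : (i : Fin k) → Fin (s i)) i →
             comp {s = s} (build h) i ≡ h i
comp-build h zero    = refl
comp-build h (suc i) = comp-build (h ∘ suc) i

infixl 6 _[_]≔_
_[_]≔_ : ∀ {k} {s : Fin k → ℕ} → Tuple s → (j : Fin k) → Fin (s j) → Tuple s
a [ j ]≔ c = build (update (comp a) j c)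

[]≔-comp : ∀ {k} {s : Fin k → ℕ} (a : Tuple s) j → a [ j ]≔ comp a j ≡ a
[]≔-comp {s = s} a j = Tuple-ext {s = s} λ i → trans (comp-build _ i) (update-id (comp a) j i)

[]≔-cong : ∀ {k} {s : Fin k → ℕ} {a b : Tuple s} j c → (∀ i → i ≢ j → comp a i ≡ comp b i) →
           a [ j ]≔ c ≡ b [ j ]≔ c
[]≔-cong {s = s} {a} {b} j c agree = Tuple-ext {s = s} λ i → begin
  comp (a [ j ]≔ c) i     ≡⟨ comp-build (update (comp a) j c) i ⟩
  update (comp a) j c i   ≡⟨ update-cong j c agree i ⟩
  update (comp b) j c i   ≡⟨ comp-build (update (comp b) j c) i ⟨
  comp (b [ j ]≔ c) i     ∎
  where open ≡-Reasoning

anyᵇ : ∀ {n} → (Fin n → Bool) → Bool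
anyᵇ p = does (any? (T? ∘ p))

anyᵇ-intro : ∀ {n} (p : Fin n → Bool) c → T (p c) → T (anyᵇ p)
anyᵇ-intro p c pc = from T-≡ (dec-true (any? (T? ∘ p)) (c , pc))

anyᵇ-cong : ∀ {n} {p q : Fin n → Bool} → p ≗ q → anyᵇ p ≡ anyᵇ q
anyᵇ-cong {p = p} {q} p≗q = does-⇔ (mk⇔ (λ (c , pc) → c , subst T (p≗q c) pc)
                                        (λ (c , qc) → c , subst T (sym (p≗q c)) qc))
                                   (any? (T? ∘ p)) (any? (T? ∘ q))

anyᵇ-attained : ∀ {n} (p : Fin n → Bool) → Fin n → ∃ λ c → p c ≡ anyᵇ p
anyᵇ-attained p d with any? (T? ∘ p)
... | yes (c , pc) = c , dec-true (T? (p c)) pc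
... | no ∄c        = d , dec-false (T? (p d)) λ pd → ∄c (d , pd)

andVec-zipWith-mono : ∀ {A C : Set} {U U′ : A → C → Bool} → (∀ x a → T (U x a) → T (U′ x a)) →
                      ∀ {n} (xs : Vec A n) (as : Vec C n) →
                      T (andVec (Vec.zipWith U xs as)) → T (andVec (Vec.zipWith U′ xs as))
andVec-zipWith-mono U⇒U′ []       []       _  = _
andVec-zipWith-mono U⇒U′ (x ∷ xs) (a ∷ as) ok with to T-∧ ok
... | u , us = from T-∧ (U⇒U′ x a u , andVec-zipWith-mono U⇒U′ xs as us)

0≤1 : 0ℚ ≤ 1ℚ
0≤1 = nonNegative⁻¹ 1ℚ

ind-mono : ∀ {b b′} → (T b → T b′) → ind b ≤ ind b′
ind-mono {false} {false} _    = ≤-refl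
ind-mono {false} {true}  _    = 0≤1
ind-mono {true}  {true}  _    = ≤-refl
ind-mono {true}  {false} b⇒b′ = ⊥-elim (b⇒b′ _)

weight-mono : ∀ {q r r′} → 0ℚ ≤ q → r ≤ r′ → q * r ≤ q * r′
weight-mono {q} 0≤q = *-monoˡ-≤-nonNeg q {{nonNegative 0≤q}}

weight-cong : ∀ {q r r′} → 0ℚ ≤ q → (0ℚ < q → r ≡ r′) → q * r ≡ q * r′
weight-cong {q} {r} {r′} 0≤q r≡r′ with <-cmp 0ℚ q
... | tri< 0<q _ _ = cong (q *_) (r≡r′ 0<q)
... | tri≈ _ refl _ = trans (*-zeroˡ r) (sym (*-zeroˡ r′))
... | tri> _ _ q<0 = ⊥-elim (<-irrefl refl (<-≤-trans q<0 0≤q))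

prodVec-map-nonNeg : ∀ {A : Set} {w : A → ℚ} → (∀ x → 0ℚ ≤ w x) → ∀ {n} (xs : Vec A n) →
                     0ℚ ≤ prodVec (Vec.map w xs)
prodVec-map-nonNeg w≥0 []       = 0≤1
prodVec-map-nonNeg {w = w} w≥0 (x ∷ xs) = nonNegative⁻¹ _
  {{nonNeg*nonNeg⇒nonNeg (w x) {{nonNegative (w≥0 x)}}
                          _     {{nonNegative (prodVec-map-nonNeg w≥0 xs)}}}}

sumℚ-map-mono : ∀ {A : Set} {f g : A → ℚ} → (∀ x → f x ≤ g x) → ∀ (L : List A) →
                sumℚ (map f L) ≤ sumℚ (map g L)
sumℚ-map-mono f≤g []      = ≤-refl
sumℚ-map-mono f≤g (x ∷ L) = +-mono-≤ (f≤g x) (sumℚ-map-mono f≤g L)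

dominated⇒≤ : ∀ {S S′ : Set} {w : S → ℚ} {w′ : S′ → ℚ} {v v′} →
              (∀ f → Σ S′ λ f′ → w f ≤ w′ f′) → Σ S (λ f → w f ≡ v) → (∀ f′ → w′ f′ ≤ v′) → v ≤ v′
dominated⇒≤ dominated (f , refl) bound with dominated f
... | f′ , w≤w′ = ≤-trans w≤w′ (bound f′)

module _ {k} (G : Game k) where

  deviate : Strategy G → (j : Fin k) → Fin (qs G j) → Fin (as G j) → Strategy G
  deviate f j z c = update f j (update (f j) z c)

  play-update : ∀ (f : Strategy G) j h x →
                play G (update f j h) x ≡ play G f x [ j ]≔ h (comp x j)
  play-update f j h x = Tuple-ext {s = as G} λ i → begin
    comp (play G (update f j h) x) i
      ≡⟨ comp-build _ i ⟩
    update f j h i (comp x i)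
      ≡⟨ update-apply (comp x) j h (λ i _ → sym (comp-build _ i)) i ⟩
    update (comp (play G f x)) j (h (comp x j)) i
      ≡⟨ comp-build _ i ⟨
    comp (play G f x [ j ]≔ h (comp x j)) i
      ∎
    where open ≡-Reasoning

  play-deviate-at : ∀ f j z c x → comp x j ≡ z → play G (deviate f j z c) x ≡ play G f x [ j ]≔ c
  play-deviate-at f j z c x refl =
    trans (play-update f j _ x) (cong (play G f x [ j ]≔_) (update-same (f j) (comp x j) c))

  play-deviate-elsewhere : ∀ f j z c x → comp x j ≢ z → play G (deviate f j z c) x ≡ play G f x
  play-deviate-elsewhere f j z c x x≢z = begin
    play G (deviate f j z c) x
      ≡⟨ play-update f j _ x ⟩
    play G f x [ j ]≔ update (f j) z c (comp x j)
      ≡⟨ cong (play G f x [ j ]≔_) (update-other (f j) z c x≢z) ⟩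
    play G f x [ j ]≔ f j (comp x j)
      ≡⟨ cong (play G f x [ j ]≔_) (comp-build _ j) ⟨
    play G f x [ j ]≔ comp (play G f x) j
      ≡⟨ []≔-comp (play G f x) j ⟩
    play G f x
      ∎
    where open ≡-Reasoning

  module _ {V′ : Tuple (qs G) → Tuple (as G) → Bool}
           (V⇒V′ : ∀ x a → T (V G x a) → T (V′ x a)) where

    winProb-mono : ∀ f → winProb G f ≤ winProb (withV G V′) f
    winProb-mono f = sumℚ-map-mono
      (λ x → weight-mono (Q-nonneg G x) (ind-mono (V⇒V′ x (play G f x))))
      (allTuples (qs G))

    winProbRep-mono : ∀ n F → winProbRep n G F ≤ winProbRep n (withV G V′) F
    winProbRep-mono n F = sumℚ-map-mono
      (λ xs → weight-mono (prodVec-map-nonNeg (Q-nonneg G) xs)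
                          (ind-mono (andVec-zipWith-mono V⇒V′ xs (playRep G F xs))))
      (allVecs n (allTuples (qs G)))

relaxAt : ∀ {k} (G : Game k) (j : Fin k) → Fin (qs G j) → Tuple (qs G) → Tuple (as G) → Bool
relaxAt G j z x a = if does (comp x j ≟ z) then anyᵇ (λ c → V G x (a [ j ]≔ c)) else V G x a

module _ {k} (G : Game k) (j : Fin k) (z : Fin (qs G j)) where

  relaxAt-at : ∀ {x} a → comp x j ≡ z → relaxAt G j z x a ≡ anyᵇ (λ c → V G x (a [ j ]≔ c))
  relaxAt-at {x} a x≡z rewrite dec-true (comp x j ≟ z) x≡z = refl

  V⇒relaxAt : ∀ x a → T (V G x a) → T (relaxAt G j z x a)
  V⇒relaxAt x a ok with comp x j ≟ z
  ... | yes _ = anyᵇ-intro _ (comp a j) (subst T (sym (cong (V G x) ([]≔-comp a j))) ok)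
  ... | no  _ = ok

  relaxAt-ignores-answer : ∀ {x} → comp x j ≡ z →
                           ∀ a b → (∀ i → i ≢ j → comp a i ≡ comp b i) →
                           relaxAt G j z x a ≡ relaxAt G j z x b
  relaxAt-ignores-answer {x} x≡z a b agree = begin
    relaxAt G j z x a                    ≡⟨ relaxAt-at a x≡z ⟩
    anyᵇ (λ c → V G x (a [ j ]≔ c))      ≡⟨ anyᵇ-cong (λ c → cong (V G x) ([]≔-cong j c agree)) ⟩
    anyᵇ (λ c → V G x (b [ j ]≔ c))      ≡⟨ relaxAt-at b x≡z ⟨
    relaxAt G j z x b                    ∎
    where open ≡-Reasoning

module BestResponse {k} (G : Game k) (y : Tuple (qs G)) (j : Fin k)
  (unique : ∀ x → 0ℚ < Q G x → comp x j ≡ comp y j → x ≡ y) where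

  bestAnswer : ∀ (f : Strategy G) →
               ∃ λ c → V G y (play G f y [ j ]≔ c) ≡ anyᵇ (λ c → V G y (play G f y [ j ]≔ c))
  bestAnswer f = anyᵇ-attained _ (f j (comp y j))

  bestResponse : Strategy G → Strategy G
  bestResponse f = deviate G f j (comp y j) (proj₁ (bestAnswer f))

  bestResponse-wins : ∀ f x → 0ℚ < Q G x →
                      V G x (play G (bestResponse f) x) ≡ relaxAt G j (comp y j) x (play G f x)
  bestResponse-wins f x 0<Qx with comp x j ≟ comp y j
  ... | no x≢y = cong (V G x) (play-deviate-elsewhere G f j _ _ x x≢y)
  ... | yes x≡y with refl ← unique x 0<Qx x≡y = begin
    V G y (play G (bestResponse f) y)
      ≡⟨ cong (V G y) (play-deviate-at G f j _ _ y refl) ⟩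
    V G y (play G f y [ j ]≔ proj₁ (bestAnswer f))
      ≡⟨ proj₂ (bestAnswer f) ⟩
    anyᵇ (λ c → V G y (play G f y [ j ]≔ c))
      ∎
    where open ≡-Reasoning

  winProb-bestResponse : ∀ f →
                         winProb G (bestResponse f) ≡ winProb (withV G (relaxAt G j (comp y j))) f
  winProb-bestResponse f = cong sumℚ (map-cong
    (λ x → weight-cong (Q-nonneg G x) λ 0<Qx → cong ind (bestResponse-wins f x 0<Qx))
    (allTuples (qs G)))

lemma3p15 : ∀ {k} (G : Game k) (y : Tuple (qs G)) (j : Fin k) →
    0ℚ < Q G y →
    (∀ x → 0ℚ < Q G x → comp x j ≡ comp y j → x ≡ y) →
    Σ (Tuple (qs G) → Tuple (as G) → Bool) λ V′ →
      (∀ a b → (∀ i → i ≢ j → comp a i ≡ comp b i) → V′ y a ≡ V′ y b) ×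
      (∀ (n : ℕ) (v v′ : ℚ) → IsValRep n G v → IsValRep n (withV G V′) v′ → v ≤ v′) ×
      (∀ (v v′ : ℚ) → IsVal (withV G V′) v′ → IsVal G v → v′ ≡ v)
lemma3p15 G y j _ unique =
    relaxAt G j (comp y j)
  , relaxAt-ignores-answer G j (comp y j) refl
  , (λ n v v′ (attained , _) (_ , bound′) →
       dominated⇒≤ (λ F → F , winProbRep-mono G V⇒V′ n F) attained bound′)
  , (λ v v′ (attained′ , bound′) (attained , bound) → ≤-antisym
       (dominated⇒≤ (λ f → bestResponse f , ≤-reflexive (sym (winProb-bestResponse f)))
                    attained′ bound)
       (dominated⇒≤ (λ f → f , winProb-mono G V⇒V′ f) attained bound′))
  where
  open BestResponse G y j unique
  V⇒V′ : ∀ x a → T (V G x a) → T (relaxAt G j (comp y j) x a)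
  V⇒V′ = V⇒relaxAt G j (comp y j)
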